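{- For all positive integers $n,p,r$, $$ \sum_{\ell=1}^n (\ell)^{(p)}H_\ell^{(r)}=A_{1}(p,r,n)H_{n}^{(r)}-B_{1}(p,r,n)\,, $$ where $$ A_{1}(p,r,n)=\sum_{m=0}^p (-1)^{p+m} s(p,m) A(m,r,n),\qquad B_{1}(p,r,n)=\sum_{m=0}^p (-1)^{p+m} s(p,m) B(m,r,n), $$ and for $m\ge0$ $$ A(m,r,n)=\sum_{\ell=0}^{m} S(m,\ell)\,\ell!\,\binom{n+r-1}{r-1}^{ -1}\binom{r+\ell-1}{\ell}\binom{r+n}{r+\ell},\qquad B(m,r,n)=\sum_{\ell=0}^{m} \frac{1}{r+\ell}S(m,\ell)\,\ell!\,\binom{r+\ell-1}{\ell}\binom{r+n-1}{r+\ell}. $$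
   Context: $H_n=\sum_{j=1}^n\frac1j$; hyperharmonic numbers: $H_n^{(1)}=H_n$, $H_n^{(r)}=\sum_{\ell=1}^n H_\ell^{(r-1)}$ for $r\ge2$. $(x)^{(p)}=x(x+1)\cdots(x+p-1)$ is the rising factorial. $s(p,m)$ are the (signed) Stirling numbers of the first kind, $x(x-1)\cdots(x-p+1)=\sum_m s(p,m)x^m$, so $(-1)^{p+m}s(p,m)$ are the unsigned ones; $S(m,\ell)$ are the Stirling numbers of the second kind; $\binom{a}{b}=0$ for $b>a$. -}

module Defs where

open import Data.Nat as ℕ using (ℕ; zero; suc)
open import Data.Integer as ℤ using (ℤ; +_)
open import Data.Rational using (ℚ; 0ℚ; 1ℚ; _+_; _*_; _-_; -_; _/_)

sumFrom : ℕ → ℕ → (ℕ → ℚ) → ℚ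
sumFrom a zero    f = 0ℚ
sumFrom a (suc k) f = f a + sumFrom (suc a) k f

-- ∑_{j=lo}^{hi} f j  (empty if hi < lo)
∑ : ℕ → ℕ → (ℕ → ℚ) → ℚ
∑ lo hi f = sumFrom lo (suc hi ℕ.∸ lo) f

ℕ→ℚ : ℕ → ℚ
ℕ→ℚ n = (+ n) / 1

ℤ→ℚ : ℤ → ℚ
ℤ→ℚ z = z / 1

-- reciprocal of a natural number (only ever applied to nonzero arguments below;
-- the value at 0 is a dummy convention)
inv : ℕ → ℚ
inv zero    = 0ℚ
inv (suc k) = (+ 1) / suc k

H : ℕ → ℚ
H n = ∑ 1 n inv

-- hyperharmonic numbers H_n^{(r)}, r ≥ 1; hyper r' n = H_n^{(r'+1)}
hyper : ℕ → ℕ → ℚ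
hyper zero     n = H n
hyper (suc r') n = ∑ 1 n (hyper r')

-- H_n^{(r)} for r ≥ 1 (value at r = 0 is the dummy H_n^{(1)}, never used)
Hyp : ℕ → ℕ → ℚ
Hyp n r = hyper (r ℕ.∸ 1) n

rising : ℕ → ℕ → ℕ
rising x zero    = 1
rising x (suc p) = rising x p ℕ.* (x ℕ.+ p)

fact : ℕ → ℕ
fact zero    = 1
fact (suc n) = suc n ℕ.* fact n

binom : ℕ → ℕ → ℕ
binom n       zero    = 1
binom zero    (suc k) = 0
binom (suc n) (suc k) = binom n k ℕ.+ binom n (suc k)

-- signed Stirling numbers of the first kind:
-- x(x-1)...(x-p+1) = ∑_m s(p,m) x^m ; s(p+1,m+1) = s(p,m) - p s(p,m+1)
stirling1 : ℕ → ℕ → ℤ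
stirling1 zero    zero    = + 1
stirling1 zero    (suc m) = + 0
stirling1 (suc p) zero    = + 0
stirling1 (suc p) (suc m) = stirling1 p m ℤ.- (+ p) ℤ.* stirling1 p (suc m)

stirling2 : ℕ → ℕ → ℕ
stirling2 zero    zero    = 1
stirling2 zero    (suc l) = 0
stirling2 (suc m) zero    = 0
stirling2 (suc m) (suc l) = stirling2 m l ℕ.+ suc l ℕ.* stirling2 m (suc l)

sgn : ℕ → ℤ
sgn zero    = + 1
sgn (suc k) = ℤ.- sgn k

A : ℕ → ℕ → ℕ → ℚ
A m r n = ∑ 0 m (λ ℓ →
  ℕ→ℚ (stirling2 m ℓ) * ℕ→ℚ (fact ℓ) * inv (binom (n ℕ.+ r ℕ.∸ 1) (r ℕ.∸ 1))
    * ℕ→ℚ (binom (r ℕ.+ ℓ ℕ.∸ 1) ℓ) * ℕ→ℚ (binom (r ℕ.+ n) (r ℕ.+ ℓ)))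

B : ℕ → ℕ → ℕ → ℚ
B m r n = ∑ 0 m (λ ℓ →
  inv (r ℕ.+ ℓ) * ℕ→ℚ (stirling2 m ℓ) * ℕ→ℚ (fact ℓ)
    * ℕ→ℚ (binom (r ℕ.+ ℓ ℕ.∸ 1) ℓ) * ℕ→ℚ (binom (r ℕ.+ n ℕ.∸ 1) (r ℕ.+ ℓ)))

A₁ : ℕ → ℕ → ℕ → ℚ
A₁ p r n = ∑ 0 p (λ m → ℤ→ℚ (sgn (p ℕ.+ m) ℤ.* stirling1 p m) * A m r n)

B₁ : ℕ → ℕ → ℕ → ℚ
B₁ p r n = ∑ 0 p (λ m → ℤ→ℚ (sgn (p ℕ.+ m) ℤ.* stirling1 p m) * B m r n)

-- Expanding (ℓ)^{(p)} = ∑_m (-1)^{p+m} s(p,m) ℓ^m and ℓ^m = ∑_j S(m,j) j! C(ℓ,j) reduces the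
-- identity to the sums ∑_{ℓ≤n} C(ℓ,j) H_ℓ^{(r)}.  By the closed form
-- H_ℓ^{(r)} = C(ℓ+r−1,r−1) (H_{ℓ+r−1} − H_{r−1}) these telescope: the induction on n needs
-- only Pascal's rule, absorption k C(a,k) = a C(a−1,k−1) and trinomial revision
-- C(r+j,j) C(r+N,r+j) = C(N,j) C(r+N,r).  The closed form itself follows by induction on r
-- from the case j = 0.
module Submission where

open import Defs
open import Data.Nat as ℕ using (ℕ; zero; suc; _≥_; _^_)
open import Data.Integer as ℤ using (ℤ; +_; -[1+_])
open import Data.Empty using (⊥-elim)
open import Level using (0ℓ)
open import Relation.Binary.PropositionalEquality
open import Relation.Nullary using (dec⇒maybe)
import Data.Integer.Properties as ℤP
import Data.Nat.Coprimality as Coprime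
import Data.Nat.Properties as ℕP
import Data.Rational.Properties as ℚP
import Tactic.RingSolver.Core.AlmostCommutativeRing as ACR

module BinomialIdentities where

  open import Data.Nat
  open import Data.Nat.Properties
  open import Data.Nat.Tactic.RingSolver using (solve-∀)
  open import Data.Product using (_,_)
  open import Data.Sum using (inj₁; inj₂)
  open import Relation.Nullary using (yes; no)
  open ≡-Reasoning

  binom-zero-above : ∀ {n k} → n < k → binom n k ≡ 0
  binom-zero-above {zero}  {suc k} _         = refl
  binom-zero-above {suc n} {suc k} (s≤s n<k) =
    cong₂ _+_ (binom-zero-above n<k) (binom-zero-above (m<n⇒m<1+n n<k))

  binom-one : ∀ n → binom n 1 ≡ n
  binom-one zero    = refl
  binom-one (suc n) = cong suc (binom-one n)

  binom-diag : ∀ n → binom n n ≡ 1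
  binom-diag zero    = refl
  binom-diag (suc n) = cong₂ _+_ (binom-diag n) (binom-zero-above (n<1+n n))

  binom-absorb : ∀ a k → suc k * binom (suc a) (suc k) ≡ suc a * binom a k
  binom-absorb zero    zero    = refl
  binom-absorb zero    (suc k) = *-zeroʳ (suc (suc k))
  binom-absorb (suc a) zero    =
    trans (*-identityˡ _) (trans (binom-one (suc (suc a))) (sym (*-identityʳ _)))
  binom-absorb (suc a) (suc k) = begin
    suc (suc k) * (x + y)                      ≡⟨ split (suc k) x y ⟩
    x + suc k * x + suc (suc k) * y            ≡⟨ cong₂ (λ u v → x + u + v) (binom-absorb a k) (binom-absorb a (suc k)) ⟩
    (u + v) + suc a * u + suc a * v            ≡⟨ merge (suc a) u v ⟩
    suc (suc a) * (u + v)                      ∎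
    where
    x y u v : ℕ
    x = binom (suc a) (suc k)
    y = binom (suc a) (suc (suc k))
    u = binom a k
    v = binom a (suc k)
    split : ∀ k x y → suc k * (x + y) ≡ x + k * x + suc k * y
    split = solve-∀
    merge : ∀ a u v → (u + v) + a * u + a * v ≡ suc a * (u + v)
    merge = solve-∀

  upper-*-binom : ∀ l j → l * binom l j ≡ j * binom l j + suc j * binom l (suc j)
  upper-*-binom l j = +-cancelʳ-≡ (binom l j) _ _ (begin
    l * binom l j + binom l j                       ≡⟨ +-comm (l * binom l j) _ ⟩
    suc l * binom l j                               ≡⟨ binom-absorb l j ⟨
    suc j * (binom l j + binom l (suc j))           ≡⟨ regroup j (binom l j) (binom l (suc j)) ⟩
    j * binom l j + suc j * binom l (suc j) + binom l j ∎)
    where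
    regroup : ∀ j x y → suc j * (x + y) ≡ j * x + suc j * y + x
    regroup = solve-∀

  fact≢0 : ∀ n → fact n ≢ 0
  fact≢0 zero    ()
  fact≢0 (suc n) eq = fact≢0 n (m+n≡0⇒m≡0 (fact n) eq)

  binom*fact*fact≡fact : ∀ k m → binom (k + m) k * (fact k * fact m) ≡ fact (k + m)
  binom*fact*fact≡fact zero    m = trans (*-identityˡ _) (*-identityˡ (fact m))
  binom*fact*fact≡fact (suc k) zero
    rewrite +-identityʳ k | binom-diag k | binom-zero-above (n<1+n k) =
      trans (+-identityʳ _) (*-identityʳ (fact (suc k)))
  binom*fact*fact≡fact (suc k) (suc m)
    with binom*fact*fact≡fact k (suc m) | binom*fact*fact≡fact (suc k) m
  ... | first | second rewrite +-suc k m = begin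
    (x + y) * ((suc k * fk) * (suc m * fm))
      ≡⟨ split x y k m fk fm ⟩
    suc k * (x * (fk * (suc m * fm))) + suc m * (y * ((suc k * fk) * fm))
      ≡⟨ cong₂ (λ u v → suc k * u + suc m * v) first second ⟩
    suc k * F + suc m * F
      ≡⟨ collect k m F ⟩
    suc (suc (k + m)) * F ∎
    where
    x y fk fm F : ℕ
    x  = binom (suc (k + m)) k
    y  = binom (suc (k + m)) (suc k)
    fk = fact k
    fm = fact m
    F  = fact (suc (k + m))
    split : ∀ x y k m fk fm → (x + y) * ((suc k * fk) * (suc m * fm))
          ≡ suc k * (x * (fk * (suc m * fm))) + suc m * (y * ((suc k * fk) * fm))
    split = solve-∀
    collect : ∀ k m F → suc k * F + suc m * F ≡ suc (suc (k + m)) * F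
    collect = solve-∀

  binom≢0 : ∀ k m → binom (k + m) k ≢ 0
  binom≢0 k m eq = fact≢0 (k + m)
    (trans (sym (binom*fact*fact≡fact k m)) (cong (_* (fact k * fact m)) eq))

  -- Both sides times j! r! t! equal (r+j+t)!.
  trinomial-revision-fact : ∀ r j t →
    binom (r + j) j * binom (r + (j + t)) (r + j) ≡ binom (j + t) j * binom (r + (j + t)) r
  trinomial-revision-fact r j t = *-cancelʳ-≡ _ _ D {{≢-nonZero D≢0}} (begin
    (b₁ * b₂) * D                                   ≡⟨ regroup b₁ b₂ (fact j) (fact r) (fact t) ⟩
    b₂ * ((b₁ * (fact j * fact r)) * fact t)        ≡⟨ cong (λ u → b₂ * (u * fact t)) fact-r+j ⟩
    b₂ * (fact (r + j) * fact t)
      ≡⟨ cong (λ x → binom x (r + j) * (fact (r + j) * fact t)) (+-assoc r j t) ⟨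
    binom (r + j + t) (r + j) * (fact (r + j) * fact t) ≡⟨ binom*fact*fact≡fact (r + j) t ⟩
    fact (r + j + t)                                ≡⟨ cong fact (+-assoc r j t) ⟩
    fact (r + (j + t))                              ≡⟨ binom*fact*fact≡fact r (j + t) ⟨
    c₂ * (fact r * fact (j + t))                    ≡⟨ cong (λ u → c₂ * (fact r * u)) (binom*fact*fact≡fact j t) ⟨
    c₂ * (fact r * (c₁ * (fact j * fact t)))        ≡⟨ regroup′ c₁ c₂ (fact j) (fact r) (fact t) ⟩
    (c₁ * c₂) * D                                   ∎)
    where
    D b₁ b₂ c₁ c₂ : ℕ
    D  = fact j * fact r * fact t
    b₁ = binom (r + j) j
    b₂ = binom (r + (j + t)) (r + j)
    c₁ = binom (j + t) j
    c₂ = binom (r + (j + t)) r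
    regroup : ∀ b₁ b₂ fj fr ft → (b₁ * b₂) * (fj * fr * ft) ≡ b₂ * ((b₁ * (fj * fr)) * ft)
    regroup = solve-∀
    regroup′ : ∀ c₁ c₂ fj fr ft → c₂ * (fr * (c₁ * (fj * ft))) ≡ (c₁ * c₂) * (fj * fr * ft)
    regroup′ = solve-∀
    fact-r+j : b₁ * (fact j * fact r) ≡ fact (r + j)
    fact-r+j = subst (λ x → binom x j * (fact j * fact r) ≡ fact x) (+-comm j r) (binom*fact*fact≡fact j r)
    D≢0 : D ≢ 0
    D≢0 eq with m*n≡0⇒m≡0∨n≡0 (fact j * fact r) eq
    ... | inj₂ e = fact≢0 t e
    ... | inj₁ e with m*n≡0⇒m≡0∨n≡0 (fact j) e
    ...   | inj₁ e′ = fact≢0 j e′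
    ...   | inj₂ e′ = fact≢0 r e′

  trinomial-revision : ∀ r j N → binom (r + j) j * binom (r + N) (r + j) ≡ binom N j * binom (r + N) r
  trinomial-revision r j N with j ≤? N
  ... | yes j≤N with m≤n⇒∃[o]m+o≡n j≤N
  ...   | t , refl = trinomial-revision-fact r j t
  trinomial-revision r j N | no j≰N
    rewrite binom-zero-above (≰⇒> j≰N) | binom-zero-above (+-monoʳ-< r (≰⇒> j≰N)) =
      *-zeroʳ (binom (r + j) j)

open BinomialIdentities
open import Data.Rational using (ℚ; 0ℚ; 1ℚ; _+_; _*_; _-_; -_; mkℚ; 1/_)
open import Tactic.RingSolver using (solve-∀)

ℚ-ring : ACR.AlmostCommutativeRing 0ℓ 0ℓ
ℚ-ring = ACR.fromCommutativeRing ℚP.+-*-commutativeRing (λ x → dec⇒maybe (0ℚ ℚP.≟ x))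

open ≡-Reasoning

-- ℤ→ℚ and inv normalise by a gcd, which does not compute on variables; rewriting them to
-- the already reduced fraction fromℤ lets the arithmetic of ℚ unfold definitionally.
fromℤ : ℤ → ℚ
fromℤ a = mkℚ a 0 (Coprime.sym (Coprime.1-coprimeTo _))

ℤ→ℚ≡fromℤ : ∀ a → ℤ→ℚ a ≡ fromℤ a
ℤ→ℚ≡fromℤ a = ℚP.↥p/↧p≡p (fromℤ a)

ℤ→ℚ-+ : ∀ a b → ℤ→ℚ (a ℤ.+ b) ≡ ℤ→ℚ a + ℤ→ℚ b
ℤ→ℚ-+ a b rewrite ℤ→ℚ≡fromℤ a | ℤ→ℚ≡fromℤ b =
  ℚP./-cong (cong₂ ℤ._+_ (sym (ℤP.*-identityʳ a)) (sym (ℤP.*-identityʳ b))) refl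

ℤ→ℚ-* : ∀ a b → ℤ→ℚ (a ℤ.* b) ≡ ℤ→ℚ a * ℤ→ℚ b
ℤ→ℚ-* a b rewrite ℤ→ℚ≡fromℤ a | ℤ→ℚ≡fromℤ b = refl

ℤ→ℚ-neg : ∀ a → ℤ→ℚ (ℤ.- a) ≡ - ℤ→ℚ a
ℤ→ℚ-neg (+ zero)  = refl
ℤ→ℚ-neg (+ suc n) = refl
ℤ→ℚ-neg -[1+ n ] rewrite ℤ→ℚ≡fromℤ (+ suc n) = refl

ℤ→ℚ-- : ∀ a b → ℤ→ℚ (a ℤ.- b) ≡ ℤ→ℚ a - ℤ→ℚ b
ℤ→ℚ-- a b = trans (ℤ→ℚ-+ a (ℤ.- b)) (cong (_+_ (ℤ→ℚ a)) (ℤ→ℚ-neg b))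

ℕ→ℚ-+ : ∀ a b → ℕ→ℚ (a ℕ.+ b) ≡ ℕ→ℚ a + ℕ→ℚ b
ℕ→ℚ-+ a b = ℤ→ℚ-+ (+ a) (+ b)

ℕ→ℚ-* : ∀ a b → ℕ→ℚ (a ℕ.* b) ≡ ℕ→ℚ a * ℕ→ℚ b
ℕ→ℚ-* a b = trans (cong ℤ→ℚ (ℤP.pos-* a b)) (ℤ→ℚ-* (+ a) (+ b))

inv≡1/fromℤ : ∀ k → inv (suc k) ≡ 1/ fromℤ (+ suc k)
inv≡1/fromℤ k = ℚP.↥p/↧p≡p (1/ fromℤ (+ suc k))

inv*ℕ→ℚ : ∀ k → k ≢ 0 → inv k * ℕ→ℚ k ≡ 1ℚ
inv*ℕ→ℚ zero    k≢0 = ⊥-elim (k≢0 refl)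
inv*ℕ→ℚ (suc k) _   rewrite inv≡1/fromℤ k | ℤ→ℚ≡fromℤ (+ suc k) = ℚP.*-inverseˡ (fromℤ (+ suc k))

ℕ→ℚ-*-inv-cross : ∀ a b x y → suc a ℕ.* x ≡ suc b ℕ.* y →
  ℕ→ℚ x * inv (suc b) ≡ ℕ→ℚ y * inv (suc a)
ℕ→ℚ-*-inv-cross a b x y eq = begin
  X * ib                  ≡⟨ ℚP.*-identityˡ (X * ib) ⟨
  1ℚ * (X * ib)           ≡⟨ cong (_* (X * ib)) (inv*ℕ→ℚ (suc a) λ ()) ⟨
  ia * a⁺ * (X * ib)      ≡⟨ regroup ia a⁺ X ib ⟩
  ia * ib * (a⁺ * X)      ≡⟨ cong (ia * ib *_) cross ⟩
  ia * ib * (b⁺ * Y)      ≡⟨ regroup′ ia ib b⁺ Y ⟩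
  Y * ia * (ib * b⁺)      ≡⟨ cong (Y * ia *_) (inv*ℕ→ℚ (suc b) λ ()) ⟩
  Y * ia * 1ℚ             ≡⟨ ℚP.*-identityʳ (Y * ia) ⟩
  Y * ia                  ∎
  where
  a⁺ b⁺ X Y ia ib : ℚ
  a⁺ = ℕ→ℚ (suc a)
  b⁺ = ℕ→ℚ (suc b)
  X  = ℕ→ℚ x
  Y  = ℕ→ℚ y
  ia = inv (suc a)
  ib = inv (suc b)
  cross : a⁺ * X ≡ b⁺ * Y
  cross = trans (sym (ℕ→ℚ-* (suc a) x)) (trans (cong ℕ→ℚ eq) (ℕ→ℚ-* (suc b) y))
  regroup : ∀ ia a⁺ X ib → ia * a⁺ * (X * ib) ≡ ia * ib * (a⁺ * X)
  regroup = solve-∀ ℚ-ring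
  regroup′ : ∀ ia ib b⁺ Y → ia * ib * (b⁺ * Y) ≡ Y * ia * (ib * b⁺)
  regroup′ = solve-∀ ℚ-ring

sumFrom-cong : ∀ a k {f g : ℕ → ℚ} → (∀ i → f i ≡ g i) → sumFrom a k f ≡ sumFrom a k g
sumFrom-cong a zero    f≡g = refl
sumFrom-cong a (suc k) f≡g = cong₂ _+_ (f≡g a) (sumFrom-cong (suc a) k f≡g)

sumFrom-zero : ∀ a k → sumFrom a k (λ _ → 0ℚ) ≡ 0ℚ
sumFrom-zero a zero    = refl
sumFrom-zero a (suc k) = cong (_+_ 0ℚ) (sumFrom-zero (suc a) k)

sumFrom-+ : ∀ a k (f g : ℕ → ℚ) → sumFrom a k (λ i → f i + g i) ≡ sumFrom a k f + sumFrom a k g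
sumFrom-+ a zero    f g = refl
sumFrom-+ a (suc k) f g = trans (cong (_+_ (f a + g a)) (sumFrom-+ (suc a) k f g))
  (swap (f a) (g a) (sumFrom (suc a) k f) (sumFrom (suc a) k g))
  where
  swap : ∀ x y z w → (x + y) + (z + w) ≡ (x + z) + (y + w)
  swap = solve-∀ ℚ-ring

sumFrom-neg : ∀ a k (f : ℕ → ℚ) → sumFrom a k (λ i → - f i) ≡ - sumFrom a k f
sumFrom-neg a zero    f = refl
sumFrom-neg a (suc k) f = trans (cong (_+_ (- f a)) (sumFrom-neg (suc a) k f))
  (sym (ℚP.neg-distrib-+ (f a) (sumFrom (suc a) k f)))

sumFrom-- : ∀ a k (f g : ℕ → ℚ) → sumFrom a k (λ i → f i - g i) ≡ sumFrom a k f - sumFrom a k g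
sumFrom-- a k f g = trans (sumFrom-+ a k f (λ i → - g i)) (cong (_+_ (sumFrom a k f)) (sumFrom-neg a k g))

sumFrom-*ˡ : ∀ a k c (f : ℕ → ℚ) → sumFrom a k (λ i → c * f i) ≡ c * sumFrom a k f
sumFrom-*ˡ a zero    c f = sym (ℚP.*-zeroʳ c)
sumFrom-*ˡ a (suc k) c f = trans (cong (_+_ (c * f a)) (sumFrom-*ˡ (suc a) k c f))
  (sym (ℚP.*-distribˡ-+ c (f a) (sumFrom (suc a) k f)))

sumFrom-*ʳ : ∀ a k c (f : ℕ → ℚ) → sumFrom a k (λ i → f i * c) ≡ sumFrom a k f * c
sumFrom-*ʳ a k c f = begin
  sumFrom a k (λ i → f i * c) ≡⟨ sumFrom-cong a k (λ i → ℚP.*-comm (f i) c) ⟩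
  sumFrom a k (λ i → c * f i) ≡⟨ sumFrom-*ˡ a k c f ⟩
  c * sumFrom a k f           ≡⟨ ℚP.*-comm c _ ⟩
  sumFrom a k f * c           ∎

sumFrom-affine : ∀ a k (f g : ℕ → ℚ) y →
  sumFrom a k (λ i → f i * y - g i) ≡ sumFrom a k f * y - sumFrom a k g
sumFrom-affine a k f g y =
  trans (sumFrom-- a k (λ i → f i * y) g) (cong (_- sumFrom a k g) (sumFrom-*ʳ a k y f))

sumFrom-suc : ∀ a k (f : ℕ → ℚ) → sumFrom (suc a) k f ≡ sumFrom a k (λ i → f (suc i))
sumFrom-suc a zero    f = refl
sumFrom-suc a (suc k) f = cong (_+_ (f (suc a))) (sumFrom-suc (suc a) k f)

sumFrom-snoc : ∀ a k (f : ℕ → ℚ) → sumFrom a (suc k) f ≡ sumFrom a k f + f (a ℕ.+ k)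
sumFrom-snoc a zero    f = begin
  f a + 0ℚ       ≡⟨ ℚP.+-identityʳ (f a) ⟩
  f a            ≡⟨ cong f (ℕP.+-identityʳ a) ⟨
  f (a ℕ.+ 0)    ≡⟨ ℚP.+-identityˡ _ ⟨
  0ℚ + f (a ℕ.+ 0) ∎
sumFrom-snoc a (suc k) f rewrite sumFrom-snoc (suc a) k f | ℕP.+-suc a k =
  sym (ℚP.+-assoc (f a) (sumFrom (suc a) k f) (f (suc (a ℕ.+ k))))

sumFrom-comm : ∀ a k b m (f : ℕ → ℕ → ℚ) →
  sumFrom a k (λ i → sumFrom b m (f i)) ≡ sumFrom b m (λ j → sumFrom a k (λ i → f i j))
sumFrom-comm a zero    b m f = sym (sumFrom-zero b m)
sumFrom-comm a (suc k) b m f = trans (cong (_+_ (sumFrom b m (f a))) (sumFrom-comm (suc a) k b m f))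
  (sym (sumFrom-+ b m (f a) (λ j → sumFrom (suc a) k (λ i → f i j))))

sumFrom-interchange : ∀ a k b m (c : ℕ → ℚ) (φ : ℕ → ℕ → ℚ) (w : ℕ → ℚ) →
  sumFrom a k (λ i → sumFrom b m (λ j → c j * φ j i) * w i)
  ≡ sumFrom b m (λ j → c j * sumFrom a k (λ i → φ j i * w i))
sumFrom-interchange a k b m c φ w = begin
  sumFrom a k (λ i → sumFrom b m (λ j → c j * φ j i) * w i)
    ≡⟨ sumFrom-cong a k (λ i → sym (sumFrom-*ʳ b m (w i) (λ j → c j * φ j i))) ⟩
  sumFrom a k (λ i → sumFrom b m (λ j → c j * φ j i * w i))
    ≡⟨ sumFrom-comm a k b m (λ i j → c j * φ j i * w i) ⟩
  sumFrom b m (λ j → sumFrom a k (λ i → c j * φ j i * w i))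
    ≡⟨ sumFrom-cong b m (λ j → trans (sumFrom-cong a k (λ i → ℚP.*-assoc (c j) (φ j i) (w i)))
                                      (sumFrom-*ˡ a k (c j) (λ i → φ j i * w i))) ⟩
  sumFrom b m (λ j → c j * sumFrom a k (λ i → φ j i * w i)) ∎

-- The step of the Stirling expansions: the y-part is reindexed by one, which is free
-- because y vanishes at both ends.
sumFrom-merge-shifted : ∀ k (x y z : ℕ → ℚ) → y 0 ≡ 0ℚ → y (suc k) ≡ 0ℚ → z 0 ≡ 0ℚ →
  (∀ i → x i + y (suc i) ≡ z (suc i)) →
  sumFrom 0 (suc k) (λ i → x i + y i) ≡ sumFrom 0 (suc (suc k)) z
sumFrom-merge-shifted k x y z y₀ y-end z₀ step = begin
  sumFrom 0 (suc k) (λ i → x i + y i)             ≡⟨ sumFrom-+ 0 (suc k) x y ⟩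
  sumFrom 0 (suc k) x + sumFrom 0 (suc k) y       ≡⟨ cong (_+_ (sumFrom 0 (suc k) x)) y-shift ⟩
  sumFrom 0 (suc k) x + sumFrom 0 (suc k) y′      ≡⟨ sumFrom-+ 0 (suc k) x y′ ⟨
  sumFrom 0 (suc k) (λ i → x i + y′ i)            ≡⟨ sumFrom-cong 0 (suc k) step ⟩
  sumFrom 0 (suc k) z′                            ≡⟨ ℚP.+-identityˡ _ ⟨
  0ℚ + sumFrom 0 (suc k) z′                       ≡⟨ cong₂ _+_ z₀ (sumFrom-suc 0 (suc k) z) ⟨
  sumFrom 0 (suc (suc k)) z                       ∎
  where
  y′ z′ : ℕ → ℚ
  y′ i = y (suc i)
  z′ i = z (suc i)
  y-shift : sumFrom 0 (suc k) y ≡ sumFrom 0 (suc k) y′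
  y-shift = begin
    y 0 + sumFrom 1 k y            ≡⟨ cong₂ _+_ y₀ (sumFrom-suc 0 k y) ⟩
    0ℚ + sumFrom 0 k y′            ≡⟨ ℚP.+-identityˡ _ ⟩
    sumFrom 0 k y′                 ≡⟨ ℚP.+-identityʳ _ ⟨
    sumFrom 0 k y′ + 0ℚ            ≡⟨ cong (_+_ (sumFrom 0 k y′)) y-end ⟨
    sumFrom 0 k y′ + y′ k          ≡⟨ sumFrom-snoc 0 k y′ ⟨
    sumFrom 0 (suc k) y′           ∎

-- Stirling expansions

-- Written exactly as in A₁ and B₁, so that those unfold to sums over it.
stirling1ᵘ : ℕ → ℕ → ℚ
stirling1ᵘ p m = ℤ→ℚ (sgn (p ℕ.+ m) ℤ.* stirling1 p m)

stirling1-zero-above : ∀ {p m} → p ℕ.< m → stirling1 p m ≡ + 0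
stirling1-zero-above {zero}  {suc m} _ = refl
stirling1-zero-above {suc p} {suc m} (ℕ.s≤s p<m)
  rewrite stirling1-zero-above p<m | stirling1-zero-above (ℕP.m<n⇒m<1+n p<m) | ℤP.*-zeroʳ (+ p) = refl

stirling1ᵘ-zero-above : ∀ p → stirling1ᵘ p (suc p) ≡ 0ℚ
stirling1ᵘ-zero-above p
  rewrite stirling1-zero-above (ℕP.n<1+n p) | ℤP.*-zeroʳ (sgn (p ℕ.+ suc p)) = refl

p*stirling1ᵘ[p,0]≡0 : ∀ p → ℕ→ℚ p * stirling1ᵘ p 0 ≡ 0ℚ
p*stirling1ᵘ[p,0]≡0 zero    = refl
p*stirling1ᵘ[p,0]≡0 (suc p) rewrite ℤP.*-zeroʳ (sgn (suc p ℕ.+ 0)) = ℚP.*-zeroʳ (ℕ→ℚ (suc p))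

stirling1ᵘ-suc : ∀ p m → stirling1ᵘ (suc p) (suc m) ≡ stirling1ᵘ p m + ℕ→ℚ p * stirling1ᵘ p (suc m)
stirling1ᵘ-suc p m rewrite ℕP.+-suc p m = begin
  ℤ→ℚ (ℤ.- (ℤ.- S) ℤ.* (s₀ ℤ.- + p ℤ.* s₁))
    ≡⟨ ℤ→ℚ-* (ℤ.- (ℤ.- S)) (s₀ ℤ.- + p ℤ.* s₁) ⟩
  ℤ→ℚ (ℤ.- (ℤ.- S)) * ℤ→ℚ (s₀ ℤ.- + p ℤ.* s₁)
    ≡⟨ cong₂ _*_ (trans (ℤ→ℚ-neg (ℤ.- S)) (cong -_ (ℤ→ℚ-neg S)))
                 (trans (ℤ→ℚ-- s₀ (+ p ℤ.* s₁)) (cong (λ z → ℤ→ℚ s₀ - z) (ℤ→ℚ-* (+ p) s₁))) ⟩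
  - - ℤ→ℚ S * (ℤ→ℚ s₀ - ℕ→ℚ p * ℤ→ℚ s₁)
    ≡⟨ expand (ℤ→ℚ S) (ℤ→ℚ s₀) (ℕ→ℚ p) (ℤ→ℚ s₁) ⟩
  ℤ→ℚ S * ℤ→ℚ s₀ + ℕ→ℚ p * (- ℤ→ℚ S * ℤ→ℚ s₁)
    ≡⟨ cong₂ (λ u v → u + ℕ→ℚ p * v) (sym (ℤ→ℚ-* S s₀))
             (trans (cong (_* ℤ→ℚ s₁) (sym (ℤ→ℚ-neg S))) (sym (ℤ→ℚ-* (ℤ.- S) s₁))) ⟩
  ℤ→ℚ (S ℤ.* s₀) + ℕ→ℚ p * ℤ→ℚ (ℤ.- S ℤ.* s₁) ∎
  where
  S s₀ s₁ : ℤ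
  S  = sgn (p ℕ.+ m)
  s₀ = stirling1 p m
  s₁ = stirling1 p (suc m)
  expand : ∀ σ a P b → - - σ * (a - P * b) ≡ σ * a + P * (- σ * b)
  expand = solve-∀ ℚ-ring

rising-expansion : ∀ x p → ℕ→ℚ (rising x p) ≡ ∑ 0 p (λ m → stirling1ᵘ p m * ℕ→ℚ (x ^ m))
rising-expansion x zero    = refl
rising-expansion x (suc p) = begin
  ℕ→ℚ (rising x p ℕ.* (x ℕ.+ p))
    ≡⟨ trans (ℕ→ℚ-* (rising x p) (x ℕ.+ p)) (cong (ℕ→ℚ (rising x p) *_) (ℕ→ℚ-+ x p)) ⟩
  ℕ→ℚ (rising x p) * (ℕ→ℚ x + ℕ→ℚ p)
    ≡⟨ cong (_* (ℕ→ℚ x + ℕ→ℚ p)) (rising-expansion x p) ⟩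
  ∑ 0 p t * (ℕ→ℚ x + ℕ→ℚ p)
    ≡⟨ sumFrom-*ʳ 0 (suc p) (ℕ→ℚ x + ℕ→ℚ p) t ⟨
  sumFrom 0 (suc p) (λ m → t m * (ℕ→ℚ x + ℕ→ℚ p))
    ≡⟨ sumFrom-cong 0 (suc p) split ⟩
  sumFrom 0 (suc p) (λ m → u m + v m)
    ≡⟨ sumFrom-merge-shifted p u v w v₀ v-end w₀ pascal ⟩
  ∑ 0 (suc p) w ∎
  where
  t u v w : ℕ → ℚ
  t m = stirling1ᵘ p m * ℕ→ℚ (x ^ m)
  u m = stirling1ᵘ p m * ℕ→ℚ (x ^ suc m)
  v m = ℕ→ℚ p * stirling1ᵘ p m * ℕ→ℚ (x ^ m)
  w m = stirling1ᵘ (suc p) m * ℕ→ℚ (x ^ m)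
  split : ∀ m → t m * (ℕ→ℚ x + ℕ→ℚ p) ≡ u m + v m
  split m = trans (distrib (stirling1ᵘ p m) (ℕ→ℚ (x ^ m)) (ℕ→ℚ x) (ℕ→ℚ p))
    (cong (λ z → stirling1ᵘ p m * z + v m) (sym (ℕ→ℚ-* x (x ^ m))))
    where
    distrib : ∀ c P X Q → c * P * (X + Q) ≡ c * (X * P) + Q * c * P
    distrib = solve-∀ ℚ-ring
  v₀ : v 0 ≡ 0ℚ
  v₀ = trans (cong (_* 1ℚ) (p*stirling1ᵘ[p,0]≡0 p)) (ℚP.*-zeroˡ 1ℚ)
  v-end : v (suc p) ≡ 0ℚ
  v-end rewrite stirling1ᵘ-zero-above p =
    trans (cong (_* ℕ→ℚ (x ^ suc p)) (ℚP.*-zeroʳ (ℕ→ℚ p))) (ℚP.*-zeroˡ (ℕ→ℚ (x ^ suc p)))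
  w₀ : w 0 ≡ 0ℚ
  w₀ rewrite ℤP.*-zeroʳ (sgn (suc p ℕ.+ 0)) = ℚP.*-zeroˡ 1ℚ
  pascal : ∀ m → u m + v (suc m) ≡ w (suc m)
  pascal m rewrite stirling1ᵘ-suc p m =
    collect (stirling1ᵘ p m) (ℕ→ℚ (x ^ suc m)) (stirling1ᵘ p (suc m)) (ℕ→ℚ p)
    where
    collect : ∀ c P c′ Q → c * P + Q * c′ * P ≡ (c + Q * c′) * P
    collect = solve-∀ ℚ-ring

stirling2-zero-above : ∀ {m l} → m ℕ.< l → stirling2 m l ≡ 0
stirling2-zero-above {zero}  {suc l} _ = refl
stirling2-zero-above {suc m} {suc l} (ℕ.s≤s m<l)
  rewrite stirling2-zero-above m<l | stirling2-zero-above (ℕP.m<n⇒m<1+n m<l) = ℕP.*-zeroʳ (suc l)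

pow-expansion : ∀ x m →
  ℕ→ℚ (x ^ m) ≡ ∑ 0 m (λ j → ℕ→ℚ (stirling2 m j) * ℕ→ℚ (fact j) * ℕ→ℚ (binom x j))
pow-expansion x zero    = refl
pow-expansion x (suc m) = begin
  ℕ→ℚ (x ℕ.* x ^ m)                                  ≡⟨ ℕ→ℚ-* x (x ^ m) ⟩
  ℕ→ℚ x * ℕ→ℚ (x ^ m)                                ≡⟨ cong (ℕ→ℚ x *_) (pow-expansion x m) ⟩
  ℕ→ℚ x * ∑ 0 m t                                    ≡⟨ sumFrom-*ˡ 0 (suc m) (ℕ→ℚ x) t ⟨
  sumFrom 0 (suc m) (λ j → ℕ→ℚ x * t j)              ≡⟨ sumFrom-cong 0 (suc m) split ⟩
  sumFrom 0 (suc m) (λ j → u j + v j)                ≡⟨ sumFrom-merge-shifted m u v w v₀ v-end w₀ pascal ⟩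
  ∑ 0 (suc m) w                                      ∎
  where
  S C t u v w : ℕ → ℚ
  S j = ℕ→ℚ (stirling2 m j)
  C j = ℕ→ℚ (binom x j)
  t j = S j * ℕ→ℚ (fact j) * C j
  u j = S j * ℕ→ℚ (fact (suc j)) * C (suc j)
  v j = S j * ℕ→ℚ (fact j) * ℕ→ℚ j * C j
  w j = ℕ→ℚ (stirling2 (suc m) j) * ℕ→ℚ (fact j) * C j
  upper : ∀ j → ℕ→ℚ x * C j ≡ ℕ→ℚ j * C j + ℕ→ℚ (suc j) * C (suc j)
  upper j = begin
    ℕ→ℚ x * C j                                      ≡⟨ ℕ→ℚ-* x (binom x j) ⟨
    ℕ→ℚ (x ℕ.* binom x j)                            ≡⟨ cong ℕ→ℚ (upper-*-binom x j) ⟩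
    ℕ→ℚ (j ℕ.* binom x j ℕ.+ suc j ℕ.* binom x (suc j))
      ≡⟨ trans (ℕ→ℚ-+ (j ℕ.* binom x j) _)
               (cong₂ _+_ (ℕ→ℚ-* j (binom x j)) (ℕ→ℚ-* (suc j) (binom x (suc j)))) ⟩
    ℕ→ℚ j * C j + ℕ→ℚ (suc j) * C (suc j)            ∎
  split : ∀ j → ℕ→ℚ x * t j ≡ u j + v j
  split j = begin
    ℕ→ℚ x * t j                                      ≡⟨ regroup (ℕ→ℚ x) (S j) F (C j) ⟩
    S j * F * (ℕ→ℚ x * C j)                          ≡⟨ cong (S j * F *_) (upper j) ⟩
    S j * F * (ℕ→ℚ j * C j + ℕ→ℚ (suc j) * C (suc j))
      ≡⟨ distribute (S j) F (ℕ→ℚ j) (C j) (ℕ→ℚ (suc j)) (C (suc j)) ⟩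
    S j * (ℕ→ℚ (suc j) * F) * C (suc j) + v j
      ≡⟨ cong (λ z → S j * z * C (suc j) + v j) (ℕ→ℚ-* (suc j) (fact j)) ⟨
    u j + v j                                        ∎
    where
    F : ℚ
    F = ℕ→ℚ (fact j)
    regroup : ∀ X s f c → X * (s * f * c) ≡ s * f * (X * c)
    regroup = solve-∀ ℚ-ring
    distribute : ∀ s f J c J′ c′ → s * f * (J * c + J′ * c′) ≡ s * (J′ * f) * c′ + s * f * J * c
    distribute = solve-∀ ℚ-ring
  v₀ : v 0 ≡ 0ℚ
  v₀ = trans (cong (_* C 0) (ℚP.*-zeroʳ (S 0 * 1ℚ))) (ℚP.*-zeroˡ (C 0))
  v-end : v (suc m) ≡ 0ℚ
  v-end rewrite stirling2-zero-above (ℕP.n<1+n m) =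
    vanish (ℕ→ℚ (fact (suc m))) (ℕ→ℚ (suc m)) (C (suc m))
    where
    vanish : ∀ a b c → 0ℚ * a * b * c ≡ 0ℚ
    vanish = solve-∀ ℚ-ring
  w₀ : w 0 ≡ 0ℚ
  w₀ = ℚP.*-zeroˡ (C 0)
  pascal : ∀ j → u j + v (suc j) ≡ w (suc j)
  pascal j = begin
    u j + v (suc j)                                  ≡⟨ collect (S j) (S (suc j)) F′ (ℕ→ℚ (suc j)) (C (suc j)) ⟩
    (S j + ℕ→ℚ (suc j) * S (suc j)) * F′ * C (suc j)
      ≡⟨ cong (λ z → z * F′ * C (suc j))
              (trans (ℕ→ℚ-+ (stirling2 m j) _) (cong (_+_ (S j)) (ℕ→ℚ-* (suc j) (stirling2 m (suc j))))) ⟨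
    w (suc j)                                        ∎
    where
    F′ : ℚ
    F′ = ℕ→ℚ (fact (suc j))
    collect : ∀ s s′ f J c → s * f * c + s′ * f * J * c ≡ (s + J * s′) * f * c
    collect = solve-∀ ℚ-ring

-- Hyperharmonic numbers

ΔH : ℕ → ℕ → ℚ
ΔH r n = H (r ℕ.+ n) - H r

H-suc : ∀ k → H (suc k) ≡ H k + inv (suc k)
H-suc k = sumFrom-snoc 1 k inv

ΔH-suc : ∀ r n → ΔH r (suc n) ≡ ΔH r n + inv (suc (r ℕ.+ n))
ΔH-suc r n rewrite ℕP.+-suc r n | H-suc (r ℕ.+ n) = shift (H (r ℕ.+ n)) (inv (suc (r ℕ.+ n))) (H r)
  where
  shift : ∀ a b c → a + b - c ≡ a - c + b
  shift = solve-∀ ℚ-ring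

ℕ→ℚ-trinomial-revision : ∀ r j n →
  ℕ→ℚ (binom (r ℕ.+ j) j) * ℕ→ℚ (binom (suc (r ℕ.+ n)) (r ℕ.+ j))
  ≡ ℕ→ℚ (binom (suc n) j) * ℕ→ℚ (binom (r ℕ.+ suc n) r)
ℕ→ℚ-trinomial-revision r j n = begin
  ℕ→ℚ (binom (r ℕ.+ j) j) * ℕ→ℚ (binom (suc (r ℕ.+ n)) (r ℕ.+ j))
    ≡⟨ cong (λ M → ℕ→ℚ (binom (r ℕ.+ j) j) * ℕ→ℚ (binom M (r ℕ.+ j))) (ℕP.+-suc r n) ⟨
  ℕ→ℚ (binom (r ℕ.+ j) j) * ℕ→ℚ (binom (r ℕ.+ suc n) (r ℕ.+ j))
    ≡⟨ ℕ→ℚ-* (binom (r ℕ.+ j) j) (binom (r ℕ.+ suc n) (r ℕ.+ j)) ⟨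
  ℕ→ℚ (binom (r ℕ.+ j) j ℕ.* binom (r ℕ.+ suc n) (r ℕ.+ j))
    ≡⟨ cong ℕ→ℚ (trinomial-revision r j (suc n)) ⟩
  ℕ→ℚ (binom (suc n) j ℕ.* binom (r ℕ.+ suc n) r)
    ≡⟨ ℕ→ℚ-* (binom (suc n) j) (binom (r ℕ.+ suc n) r) ⟩
  ℕ→ℚ (binom (suc n) j) * ℕ→ℚ (binom (r ℕ.+ suc n) r) ∎

∑-binom-ΔH : ∀ r j n →
  sumFrom 1 n (λ l → ℕ→ℚ (binom l j) * (ℕ→ℚ (binom (r ℕ.+ l) r) * ΔH r l))
  ≡ ℕ→ℚ (binom (r ℕ.+ j) j) * (ℕ→ℚ (binom (suc (r ℕ.+ n)) (suc (r ℕ.+ j))) * ΔH r n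
                                 - ℕ→ℚ (binom (r ℕ.+ n) (suc (r ℕ.+ j))) * inv (suc (r ℕ.+ j)))
∑-binom-ΔH r j zero = sym (begin
  c * (X * ΔH r 0 - ℕ→ℚ (binom (r ℕ.+ 0) K) * iK)
    ≡⟨ cong (λ M → c * (X * (H M - H r) - ℕ→ℚ (binom M K) * iK)) (ℕP.+-identityʳ r) ⟩
  c * (X * (H r - H r) - ℕ→ℚ (binom r K) * iK)
    ≡⟨ cong (λ b → c * (X * (H r - H r) - ℕ→ℚ b * iK)) (binom-zero-above (ℕ.s≤s (ℕP.m≤m+n r j))) ⟩
  c * (X * (H r - H r) - 0ℚ * iK)                   ≡⟨ vanish c X (H r) iK ⟩
  0ℚ                                                ∎)
  where
  K : ℕ
  K = suc (r ℕ.+ j)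
  c X iK : ℚ
  c  = ℕ→ℚ (binom (r ℕ.+ j) j)
  X  = ℕ→ℚ (binom (suc (r ℕ.+ 0)) K)
  iK = inv K
  vanish : ∀ c X h i → c * (X * (h - h) - 0ℚ * i) ≡ 0ℚ
  vanish = solve-∀ ℚ-ring
∑-binom-ΔH r j (suc n) = begin
  sumFrom 1 (suc n) f         ≡⟨ sumFrom-snoc 1 n f ⟩
  sumFrom 1 n f + f (suc n)   ≡⟨ cong₂ _+_ (∑-binom-ΔH r j n) last-term ⟩
  c * (a₂ * h - b₂ * iK) + c * a₁ * (h + iN)
    ≡⟨ add-zero (c * (a₂ * h - b₂ * iK)) (c * a₁ * (h + iN)) c (b₁ * iK) ⟩
  c * (a₂ * h - b₂ * iK) + c * a₁ * (h + iN) + c * (b₁ * iK - b₁ * iK)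
    ≡⟨ cong (λ z → c * (a₂ * h - b₂ * iK) + c * a₁ * (h + iN) + c * (z - b₁ * iK)) absorption ⟨
  c * (a₂ * h - b₂ * iK) + c * a₁ * (h + iN) + c * (a₂ * iN - b₁ * iK)
    ≡⟨ collect c a₁ a₂ b₁ b₂ h iN iK ⟩
  c * ((a₁ + a₂) * (h + iN) - (b₁ + b₂) * iK)
    ≡⟨ cong₂ (λ u v → c * (u * (h + iN) - v * iK))
             (ℕ→ℚ-+ (binom N (r ℕ.+ j)) (binom N K)) (ℕ→ℚ-+ (binom (r ℕ.+ n) (r ℕ.+ j)) (binom (r ℕ.+ n) K)) ⟨
  c * (ℕ→ℚ (binom (suc N) K) * (h + iN) - ℕ→ℚ (binom N K) * iK)
    ≡⟨ cong₂ (λ M z → c * (ℕ→ℚ (binom (suc M) K) * z - ℕ→ℚ (binom M K) * iK))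
             (ℕP.+-suc r n) (ΔH-suc r n) ⟨
  c * (ℕ→ℚ (binom (suc (r ℕ.+ suc n)) K) * ΔH r (suc n) - ℕ→ℚ (binom (r ℕ.+ suc n) K) * iK) ∎
  where
  N K : ℕ
  N = suc (r ℕ.+ n)
  K = suc (r ℕ.+ j)
  f : ℕ → ℚ
  f l = ℕ→ℚ (binom l j) * (ℕ→ℚ (binom (r ℕ.+ l) r) * ΔH r l)
  c a₁ a₂ b₁ b₂ e₁ e₂ h iN iK : ℚ
  c  = ℕ→ℚ (binom (r ℕ.+ j) j)
  a₁ = ℕ→ℚ (binom N (r ℕ.+ j))
  a₂ = ℕ→ℚ (binom N K)
  b₁ = ℕ→ℚ (binom (r ℕ.+ n) (r ℕ.+ j))
  b₂ = ℕ→ℚ (binom (r ℕ.+ n) K)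
  e₁ = ℕ→ℚ (binom (suc n) j)
  e₂ = ℕ→ℚ (binom (r ℕ.+ suc n) r)
  h  = ΔH r n
  iN = inv N
  iK = inv K
  absorption : a₂ * iN ≡ b₁ * iK
  absorption = ℕ→ℚ-*-inv-cross (r ℕ.+ j) (r ℕ.+ n) (binom N K) (binom (r ℕ.+ n) (r ℕ.+ j))
                 (binom-absorb (r ℕ.+ n) (r ℕ.+ j))
  last-term : f (suc n) ≡ c * a₁ * (h + iN)
  last-term = begin
    f (suc n)                  ≡⟨ cong (λ z → e₁ * (e₂ * z)) (ΔH-suc r n) ⟩
    e₁ * (e₂ * (h + iN))       ≡⟨ ℚP.*-assoc e₁ e₂ (h + iN) ⟨
    e₁ * e₂ * (h + iN)         ≡⟨ cong (_* (h + iN)) (ℕ→ℚ-trinomial-revision r j n) ⟨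
    c * a₁ * (h + iN)          ∎
  add-zero : ∀ x y c e → x + y ≡ x + y + c * (e - e)
  add-zero = solve-∀ ℚ-ring
  collect : ∀ c a₁ a₂ b₁ b₂ h iN iK →
    c * (a₂ * h - b₂ * iK) + c * a₁ * (h + iN) + c * (a₂ * iN - b₁ * iK)
    ≡ c * ((a₁ + a₂) * (h + iN) - (b₁ + b₂) * iK)
  collect = solve-∀ ℚ-ring

∑-ΔH : ∀ r n → sumFrom 1 n (λ l → ℕ→ℚ (binom (r ℕ.+ l) r) * ΔH r l)
             ≡ ℕ→ℚ (binom (suc (r ℕ.+ n)) (suc r)) * ΔH (suc r) n
∑-ΔH r n with ∑-binom-ΔH r 0 n
... | by-parts rewrite ℕP.+-identityʳ r = begin
  sumFrom 1 n (λ l → ℕ→ℚ (binom (r ℕ.+ l) r) * ΔH r l)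
    ≡⟨ sumFrom-cong 1 n (λ l → ℚP.*-identityˡ (ℕ→ℚ (binom (r ℕ.+ l) r) * ΔH r l)) ⟨
  sumFrom 1 n (λ l → ℕ→ℚ (binom l 0) * (ℕ→ℚ (binom (r ℕ.+ l) r) * ΔH r l))
    ≡⟨ by-parts ⟩
  1ℚ * (X * ΔH r n - ℕ→ℚ (binom M (suc r)) * iR)  ≡⟨ cong (λ z → 1ℚ * (X * ΔH r n - z)) pascal-absorb ⟩
  1ℚ * (X * ΔH r n - (X * iR - X * iM))          ≡⟨ regroup X (H M) (H r) iM iR ⟩
  X * ((H M + iM) - (H r + iR))                  ≡⟨ cong₂ (λ u v → X * (u - v)) (H-suc M) (H-suc r) ⟨
  X * ΔH (suc r) n                               ∎
  where
  M : ℕ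
  M = r ℕ.+ n
  X iR iM : ℚ
  X  = ℕ→ℚ (binom (suc M) (suc r))
  iR = inv (suc r)
  iM = inv (suc M)
  pascal-absorb : ℕ→ℚ (binom M (suc r)) * iR ≡ X * iR - X * iM
  pascal-absorb = begin
    ℕ→ℚ (binom M (suc r)) * iR
      ≡⟨ split (ℕ→ℚ (binom M r)) (ℕ→ℚ (binom M (suc r))) iR ⟩
    (ℕ→ℚ (binom M r) + ℕ→ℚ (binom M (suc r))) * iR - ℕ→ℚ (binom M r) * iR
      ≡⟨ cong₂ (λ u v → u * iR - v) (ℕ→ℚ-+ (binom M r) (binom M (suc r)))
               (ℕ→ℚ-*-inv-cross r M (binom (suc M) (suc r)) (binom M r) (binom-absorb M r)) ⟨
    X * iR - X * iM ∎
    where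
    split : ∀ a b i → b * i ≡ (a + b) * i - a * i
    split = solve-∀ ℚ-ring
  regroup : ∀ X a b iM iR → 1ℚ * (X * (a - b) - (X * iR - X * iM)) ≡ X * ((a + iM) - (b + iR))
  regroup = solve-∀ ℚ-ring

hyper-closed-form : ∀ r n → hyper r n ≡ ℕ→ℚ (binom (r ℕ.+ n) r) * ΔH r n
hyper-closed-form zero    n = unit (H n)
  where
  unit : ∀ h → h ≡ 1ℚ * (h - 0ℚ)
  unit = solve-∀ ℚ-ring
hyper-closed-form (suc r) n = begin
  sumFrom 1 n (hyper r)                                   ≡⟨ sumFrom-cong 1 n (hyper-closed-form r) ⟩
  sumFrom 1 n (λ l → ℕ→ℚ (binom (r ℕ.+ l) r) * ΔH r l)    ≡⟨ ∑-ΔH r n ⟩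
  ℕ→ℚ (binom (suc (r ℕ.+ n)) (suc r)) * ΔH (suc r) n      ∎

inv-binom*binom : ∀ r n → inv (binom (n ℕ.+ suc r ℕ.∸ 1) r) * ℕ→ℚ (binom (r ℕ.+ n) r) ≡ 1ℚ
inv-binom*binom r n = trans (cong (λ M → inv (binom M r) * ℕ→ℚ (binom (r ℕ.+ n) r)) M≡r+n)
                            (inv*ℕ→ℚ (binom (r ℕ.+ n) r) (binom≢0 r n))
  where
  M≡r+n : n ℕ.+ suc r ℕ.∸ 1 ≡ r ℕ.+ n
  M≡r+n = trans (cong (ℕ._∸ 1) (ℕP.+-suc n r)) (ℕP.+-comm n r)

∑-pow-hyper : ∀ r n m →
  sumFrom 1 n (λ l → ℕ→ℚ (l ^ m) * hyper r l) ≡ A m (suc r) n * hyper r n - B m (suc r) n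
∑-pow-hyper r n m = begin
  sumFrom 1 n (λ l → ℕ→ℚ (l ^ m) * hyper r l)
    ≡⟨ sumFrom-cong 1 n (λ l → cong₂ _*_ (pow-expansion l m) (hyper-closed-form r l)) ⟩
  sumFrom 1 n (λ l → ∑ 0 m (λ j → s j * ℕ→ℚ (binom l j)) * w l)
    ≡⟨ sumFrom-interchange 1 n 0 (suc m) s (λ j l → ℕ→ℚ (binom l j)) w ⟩
  ∑ 0 m (λ j → s j * sumFrom 1 n (λ l → ℕ→ℚ (binom l j) * w l))
    ≡⟨ sumFrom-cong 0 (suc m) (λ j → cong (s j *_) (∑-binom-ΔH r j n)) ⟩
  ∑ 0 m (λ j → s j * (C j * (X j * ΔH r n - Y j * iK j)))
    ≡⟨ sumFrom-cong 0 (suc m) term ⟨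
  ∑ 0 m (λ j → a j * hyper r n - b j)
    ≡⟨ sumFrom-affine 0 (suc m) a b (hyper r n) ⟩
  A m (suc r) n * hyper r n - B m (suc r) n ∎
  where
  ib : ℚ
  ib = inv (binom (n ℕ.+ suc r ℕ.∸ 1) r)
  s C X Y iK a b w : ℕ → ℚ
  s j  = ℕ→ℚ (stirling2 m j) * ℕ→ℚ (fact j)
  C j  = ℕ→ℚ (binom (r ℕ.+ j) j)
  X j  = ℕ→ℚ (binom (suc (r ℕ.+ n)) (suc (r ℕ.+ j)))
  Y j  = ℕ→ℚ (binom (r ℕ.+ n) (suc (r ℕ.+ j)))
  iK j = inv (suc (r ℕ.+ j))
  a j  = s j * ib * C j * X j
  b j  = iK j * ℕ→ℚ (stirling2 m j) * ℕ→ℚ (fact j) * C j * Y j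
  w l  = ℕ→ℚ (binom (r ℕ.+ l) r) * ΔH r l
  term : ∀ j → a j * hyper r n - b j ≡ s j * (C j * (X j * ΔH r n - Y j * iK j))
  term j = begin
    a j * hyper r n - b j                               ≡⟨ cong (λ z → a j * z - b j) (hyper-closed-form r n) ⟩
    a j * (Cₙ * ΔH r n) - b j
      ≡⟨ regroup (ℕ→ℚ (stirling2 m j)) (ℕ→ℚ (fact j)) ib (C j) (X j) Cₙ (ΔH r n) (iK j) (Y j) ⟩
    (ib * Cₙ) * (s j * (C j * (X j * ΔH r n))) - s j * (C j * (Y j * iK j))
      ≡⟨ cong (λ u → u * (s j * (C j * (X j * ΔH r n))) - s j * (C j * (Y j * iK j))) (inv-binom*binom r n) ⟩
    1ℚ * (s j * (C j * (X j * ΔH r n))) - s j * (C j * (Y j * iK j))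
      ≡⟨ factor (s j) (C j) (X j * ΔH r n) (Y j * iK j) ⟩
    s j * (C j * (X j * ΔH r n - Y j * iK j))           ∎
    where
    Cₙ : ℚ
    Cₙ = ℕ→ℚ (binom (r ℕ.+ n) r)
    regroup : ∀ S F ib C X Cₙ h iK Y → S * F * ib * C * X * (Cₙ * h) - iK * S * F * C * Y
            ≡ (ib * Cₙ) * (S * F * (C * (X * h))) - S * F * (C * (Y * iK))
    regroup = solve-∀ ℚ-ring
    factor : ∀ s C u v → 1ℚ * (s * (C * u)) - s * (C * v) ≡ s * (C * (u - v))
    factor = solve-∀ ℚ-ring

-- The hypotheses n ≥ 1 and p ≥ 1 are not needed; r ≥ 1 is, since Hyp n 0 is a dummy value.
corollary3 : (n p r : ℕ) → n ≥ 1 → p ≥ 1 → r ≥ 1 →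
    ∑ 1 n (λ ℓ → ℕ→ℚ (rising ℓ p) * Hyp ℓ r) ≡ A₁ p r n * Hyp n r - B₁ p r n
corollary3 n p (suc r) _ _ _ = begin
  sumFrom 1 n (λ l → ℕ→ℚ (rising l p) * hyper r l)
    ≡⟨ sumFrom-cong 1 n (λ l → cong (_* hyper r l) (rising-expansion l p)) ⟩
  sumFrom 1 n (λ l → ∑ 0 p (λ m → stirling1ᵘ p m * ℕ→ℚ (l ^ m)) * hyper r l)
    ≡⟨ sumFrom-interchange 1 n 0 (suc p) (stirling1ᵘ p) (λ m l → ℕ→ℚ (l ^ m)) (hyper r) ⟩
  ∑ 0 p (λ m → stirling1ᵘ p m * sumFrom 1 n (λ l → ℕ→ℚ (l ^ m) * hyper r l))
    ≡⟨ sumFrom-cong 0 (suc p) (λ m → cong (stirling1ᵘ p m *_) (∑-pow-hyper r n m)) ⟩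
  ∑ 0 p (λ m → stirling1ᵘ p m * (A m (suc r) n * hyper r n - B m (suc r) n))
    ≡⟨ sumFrom-cong 0 (suc p) (λ m → distrib (stirling1ᵘ p m) (A m (suc r) n) (hyper r n) (B m (suc r) n)) ⟩
  ∑ 0 p (λ m → a m * hyper r n - b m)
    ≡⟨ sumFrom-affine 0 (suc p) a b (hyper r n) ⟩
  A₁ p (suc r) n * hyper r n - B₁ p (suc r) n ∎
  where
  a b : ℕ → ℚ
  a m = stirling1ᵘ p m * A m (suc r) n
  b m = stirling1ᵘ p m * B m (suc r) n
  distrib : ∀ c a y b → c * (a * y - b) ≡ c * a * y - c * b
  distrib = solve-∀ ℚ-ring
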